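{- Let $\lambda$ be a mancala configuration, $s\in\mathbb N$ and $q\ge2$ an integer such that (i) $\lambda$ is $s$-monotone; (ii) $\lambda\ge M^{q-1}$; (iii) $\ell(\lambda)=q-1$ (i.e. $\lambda_q=0$). Then $\Phi^q(\lambda)$ is $(s+1)$-monotone.
   Context: A mancala configuration is $\lambda:\mathbb N^*\to\mathbb N$ whose support equals $\{1,\dots,\ell(\lambda)\}$. Move $\Phi$: $\mu=\Phi(\lambda)$, $\mu_i=\lambda_{i+1}+1$ for $1\le i\le\lambda_1$, $\mu_i=\lambda_{i+1}$ for $i>\lambda_1$; $\Phi^t$ its iterate. Order is componentwise; marching group $M^j_i=j-i+1$ for $i\le j$, $0$ otherwise. Energy sequence of nonzero $\lambda$: with $m=\max\{\lambda_1,\ell(\lambda)\}$, $e_i=\lambda_i+i-1$ for $1\le i\le m$, extended $m$-periodically to $\mathbb Z$. For $s\ge1$, $\lambda$ is $s$-monotone if $\lambda_1\le\ell(\lambda)+1$ and $e_j\le e_i+1$ for all integers $i<j\le i+s$; every configuration is $0$-monotone. -}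

module Defs where

open import Data.Nat as ℕ using (ℕ; zero; suc; _+_; _∸_; _≤_; _<_; _⊔_; _<ᵇ_; NonZero)
open import Data.Integer as ℤ using (ℤ; +_; _%ℕ_)
open import Data.Bool using (if_then_else_)
open import Data.Product using (_×_; ∃-syntax)
open import Data.Sum using (_⊎_)
open import Relation.Binary.PropositionalEquality using (_≡_; _≢_)

-- Convention: a map λ : ℕ* → ℕ is represented by a function ℕ → ℕ
-- with 0-based indexing, i.e. (λ k) stands for λ_{k+1}.
Conf : Set
Conf = ℕ → ℕ

HasLength : Conf → ℕ → Set
HasLength λ′ ℓ = ∀ k → (k < ℓ → λ′ k ≢ 0) × (ℓ ≤ k → λ′ k ≡ 0)

IsMancala : Conf → Set
IsMancala λ′ = ∃[ ℓ ] HasLength λ′ ℓ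

-- The move Φ:  μ_i = λ_{i+1} + 1 for 1 ≤ i ≤ λ_1, μ_i = λ_{i+1} otherwise.
-- 0-based: μ k = λ (k+1) + 1 if k < λ 0, else λ (k+1).
Φ : Conf → Conf
Φ λ′ k = if k <ᵇ λ′ 0 then suc (λ′ (suc k)) else λ′ (suc k)

Φ^ : ℕ → Conf → Conf
Φ^ zero    λ′ = λ′
Φ^ (suc t) λ′ = Φ (Φ^ t λ′)

-- marching group M^j: M^j_i = j - i + 1 for i ≤ j, else 0 (1-based i).
-- 0-based k = i - 1: M^j k = j ∸ k.
M : ℕ → Conf
M j k = j ∸ k

_≤C_ : Conf → Conf → Set
μ ≤C λ′ = ∀ k → μ k ≤ λ′ k

-- Energy sequence with period m = max{λ_1, ℓ} ≥ 1, indexed by integers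
-- (1-based): e_i = λ_r + r - 1 where r ∈ {1..m}, r ≡ i (mod m).
-- With r₀ = (i - 1) mod m ∈ {0..m-1}:  e_i = λ (r₀) + r₀ (0-based λ).
energy : Conf → (m : ℕ) → .{{NonZero m}} → ℤ → ℕ
energy λ′ m i = λ′ r₀ + r₀
  where r₀ = (i ℤ.- ℤ.+ 1) %ℕ m

-- s-monotone (s ≥ 1 part), for λ of length ℓ; energy only used when
-- λ is nonzero, i.e. when m = max{λ_1, ℓ} ≠ 0.
MonoCond : ℕ → Conf → ℕ → Set
MonoCond s λ′ ℓ =
  λ′ 0 ≤ ℓ + 1 ×
  (∀ (nz : NonZero (λ′ 0 ⊔ ℓ)) (i j : ℤ) →
     i ℤ.< j → j ℤ.≤ i ℤ.+ + s →
     energy λ′ (λ′ 0 ⊔ ℓ) {{nz}} j ≤ energy λ′ (λ′ 0 ⊔ ℓ) {{nz}} i + 1)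

-- λ is s-monotone: every configuration is 0-monotone; for s ≥ 1 the conditions.
Monotone : ℕ → Conf → Set
Monotone s λ′ = IsMancala λ′ ×
  (s ≡ 0 ⊎ (1 ≤ s × ∀ ℓ → HasLength λ′ ℓ → MonoCond s λ′ ℓ))

-- After q = n + 1 moves (n = ℓ(λ)) every pile r ≤ n has dropped one stone on each
-- position it passed, and λ ≥ M^n keeps the piles from interfering, so μ = Φ^q λ is
-- μ_k = #{r ≤ n : G_r ≥ n + 1 + k} with G_r = λ_r + 2r (0-based indices). Hence
-- μ_a − μ_b counts the G_r in the window [n + 1 + a, n + 1 + b). s-monotonicity of λ
-- says that G rises by at most j + 1 over j ≤ s steps, so G cannot climb past a window
-- of width c + 1 ≤ s + 1 without landing in it c times: this is μ_b + b ≤ μ_a + a + 1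
-- for a < b ≤ a + s + 1. Where the periodic energy sequence of μ wraps around, the
-- inequality follows from μ_k ≤ n + 1, μ_k + k ≥ n, and the cyclic monotonicity of λ.
module Submission where

open import Defs
open import Data.Bool using (Bool; true; false; T; _∧_; not)
open import Data.Nat
open import Data.Nat.DivMod using (m<n⇒m%n≡m; [m+n]%n≡m%n)
open import Data.Nat.Properties
open import Data.Nat.Tactic.RingSolver using (solve-∀)
open import Data.Product using (_×_; _,_; ∃-syntax; proj₁; proj₂)
open import Data.Sum using (_⊎_; inj₁; inj₂; [_,_]′)
open import Relation.Binary using (tri<; tri≈; tri>)
open import Relation.Binary.PropositionalEquality
open import Relation.Nullary using (¬_; yes; no; contradiction)
open import Relation.Unary using (Pred; Decidable)

-- Counting

indicator : Bool → ℕ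
indicator true  = 1
indicator false = 0

count : (ℕ → Bool) → ℕ → ℕ
count f zero    = 0
count f (suc t) = indicator (f t) + count f t

T⇒indicator≡1 : ∀ {b} → T b → indicator b ≡ 1
T⇒indicator≡1 {true} _ = refl

indicator≤1 : ∀ b → indicator b ≤ 1
indicator≤1 true  = ≤-refl
indicator≤1 false = z≤n

count≤ : ∀ f t → count f t ≤ t
count≤ f zero    = z≤n
count≤ f (suc t) = +-mono-≤ (indicator≤1 (f t)) (count≤ f t)

count-monoʳ : ∀ f {t t′} → t ≤ t′ → count f t ≤ count f t′
count-monoʳ f {t′ = zero}  z≤n = z≤n
count-monoʳ f {t′ = suc t′} t≤ with m≤n⇒m<n∨m≡n t≤
... | inj₁ t<1+t′ = ≤-trans (count-monoʳ f (s≤s⁻¹ t<1+t′)) (m≤n+m _ _)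
... | inj₂ refl   = ≤-refl

count-pos : ∀ f {t r} → r < t → T (f r) → 1 ≤ count f t
count-pos f {t} {r} r<t fr = begin
  1                               ≤⟨ m≤m+n 1 (count f r) ⟩
  1 + count f r                   ≡⟨ cong (_+ count f r) (T⇒indicator≡1 fr) ⟨
  count f (suc r)                 ≤⟨ count-monoʳ f r<t ⟩
  count f t                       ∎
  where open ≤-Reasoning

count-≥-window : ∀ f {t} u w → u + w ≤ t → (∀ r → u ≤ r → r < u + w → T (f r)) →
               w ≤ count f t
count-≥-window f     u zero    _   _   = z≤n
count-≥-window f {t} u (suc w) u+w≤t all = begin
  suc w                       ≤⟨ s≤s (count-≥-window f u w ≤-refl inner) ⟩
  1 + count f (u + w)
    ≡⟨ cong (_+ count f (u + w)) (sym (T⇒indicator≡1 (all (u + w) (m≤m+n u w) last<))) ⟩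
  count f (suc (u + w))       ≡⟨ cong (count f) (sym (+-suc u w)) ⟩
  count f (u + suc w)         ≤⟨ count-monoʳ f u+w≤t ⟩
  count f t                   ∎
  where
  open ≤-Reasoning
  last< : u + w < u + suc w
  last< = +-monoʳ-< u ≤-refl
  inner : ∀ r → u ≤ r → r < u + w → T (f r)
  inner r u≤r r<u+w = all r u≤r (<-trans r<u+w last<)

count-≤-∸-prefix : ∀ f c t → (∀ r → r < c → r < t → ¬ T (f r)) → count f t ≤ t ∸ c
count-≤-∸-prefix f c zero    _    = z≤n
count-≤-∸-prefix f c (suc t) none with t <? c
... | yes t<c = begin
  indicator (f t) + count f t ≡⟨ cong (_+ count f t) (indicator-¬T (none t t<c ≤-refl)) ⟩
  count f t                   ≤⟨ count-≤-∸-prefix f c t (λ r r<c r<t → none r r<c (m<n⇒m<1+n r<t)) ⟩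
  t ∸ c                       ≤⟨ ∸-monoˡ-≤ c (n≤1+n t) ⟩
  suc t ∸ c                   ∎
  where
  open ≤-Reasoning
  indicator-¬T : ∀ {b} → ¬ T b → indicator b ≡ 0
  indicator-¬T {true}  ¬tt = contradiction _ ¬tt
  indicator-¬T {false} _   = refl
... | no t≮c = begin
  indicator (f t) + count f t ≤⟨ +-mono-≤ (indicator≤1 (f t)) (count-≤-∸-prefix f c t (λ r r<c r<t → none r r<c (m<n⇒m<1+n r<t))) ⟩
  1 + (t ∸ c)                 ≡⟨ +-∸-assoc 1 (≮⇒≥ t≮c) ⟨
  suc t ∸ c                   ∎
  where open ≤-Reasoning

count-split : ∀ f g t → (∀ r → T (g r) → T (f r)) →
              count f t ≡ count g t + count (λ r → f r ∧ not (g r)) t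
count-split f g zero    _   = refl
count-split f g (suc t) g⇒f with f t | g t | g⇒f t
... | true  | true  | _ = cong suc (count-split f g t g⇒f)
... | true  | false | _ = trans (cong suc (count-split f g t g⇒f)) (sym (+-suc _ _))
... | false | false | _ = count-split f g t g⇒f
... | false | true  | ft = contradiction (ft _) λ ()

count-shift : ∀ f t → f 0 ≡ false → count f (suc t) ≡ count (λ r → f (suc r)) t
count-shift f zero    f0 = cong (λ b → indicator b + 0) f0
count-shift f (suc t) f0 = cong (indicator (f (suc t)) +_) (count-shift f t f0)

-- Crossing a window
least-below : ∀ {ℓ} {P : Pred ℕ ℓ} → Decidable P → ∀ t →
        (∀ r → r < t → ¬ P r) ⊎ ∃[ y ] (y < t × P y × ∀ r → r < y → ¬ P r)
least-below P? zero = inj₁ λ _ ()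
least-below P? (suc t) with least-below P? t
... | inj₂ (y , y<t , Py , below) = inj₂ (y , m<n⇒m<1+n y<t , Py , below)
... | inj₁ none with P? t
...   | yes Pt = inj₂ (t , ≤-refl , Pt , none)
...   | no ¬Pt = inj₁ λ r r<1+t → [ none r , (λ { refl → ¬Pt }) ]′ (m<1+n⇒m<n∨m≡n r<1+t)

greatest-below : ∀ {ℓ} {P : Pred ℕ ℓ} → Decidable P → ∀ {u} v → P u → u < v →
       ∃[ x ] (u ≤ x × x < v × P x × ∀ r → x < r → r < v → ¬ P r)
greatest-below P? {u} (suc v) Pu u<1+v with P? v
... | yes Pv = v , s≤s⁻¹ u<1+v , ≤-refl , Pv , λ r v<r r<1+v → contradiction (s≤s⁻¹ r<1+v) (<⇒≱ v<r)
... | no ¬Pv with greatest-below P? v Pu (≤∧≢⇒< (s≤s⁻¹ u<1+v) λ { refl → ¬Pv Pu })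
...   | x , u≤x , x<v , Px , above = x , u≤x , m<n⇒m<1+n x<v , Px ,
          λ r x<r r<1+v → [ above r x<r , (λ { refl → ¬Pv }) ]′ (m<1+n⇒m<n∨m≡n r<1+v)

between : ℕ → ℕ → ℕ → Bool
between A B x = (A ≤ᵇ x) ∧ not (B ≤ᵇ x)

between-intro : ∀ {A B x} → A ≤ x → x < B → T (between A B x)
between-intro {A} {B} {x} A≤x x<B with A ≤ᵇ x | ≤⇒≤ᵇ A≤x | B ≤ᵇ x | ≤ᵇ⇒≤ B x
... | true | _ | false | _   = _
... | true | _ | true  | B≤x = contradiction (B≤x _) (<⇒≱ x<B)

between-below : ∀ {A B x} → x < A → between A B x ≡ false
between-below {A} {B} {x} x<A with A ≤ᵇ x | ≤ᵇ⇒≤ A x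
... | false | _   = refl
... | true  | A≤x = contradiction (A≤x _) (<⇒≱ x<A)

JumpBound : (ℕ → ℕ) → ℕ → ℕ → Set
JumpBound g s N = ∀ r j → 1 ≤ j → j ≤ s → r + j ≤ N → g (r + j) ≤ g r + suc j

module _ {g : ℕ → ℕ} {s N : ℕ} (jump : JumpBound g s N) {A c : ℕ} (c≤s : c ≤ s) where

  private
    mid-run : ∀ {x y} → x < y → y ≤ N → g x < A → A + suc c ≤ g y →
             (∀ r → x < r → r < y → T (between A (A + suc c) (g r))) →
             c ≤ count (λ r → between A (A + suc c) (g r)) (suc N)
    mid-run {x} {y} x<y y≤N low-x high-y mid with m≤n⇒∃[o]m+o≡n x<y
    ... | w , refl = ≤-trans c≤w (count-≥-window _ (suc x) w (m≤n⇒m≤1+n y≤N) mid)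
      where
      c≤w : c ≤ w
      c≤w with suc w ≤? s
      ... | no  w≥s = ≤-trans c≤s (s≤s⁻¹ (≰⇒> w≥s))
      ... | yes 1+w≤s = s≤s⁻¹ (s≤s⁻¹ (+-cancelˡ-< A (suc c) (suc (suc w)) (begin-strict
        A + suc c             ≤⟨ high-y ⟩
        g (suc x + w)         ≡⟨ cong g (sym (+-suc x w)) ⟩
        g (x + suc w)         ≤⟨ jump x (suc w) (s≤s z≤n) 1+w≤s (subst (_≤ N) (sym (+-suc x w)) y≤N) ⟩
        g x + suc (suc w)     <⟨ +-monoˡ-< (suc (suc w)) low-x ⟩
        A + suc (suc w)       ∎)))
        where open ≤-Reasoning

  crossing : ∀ {v} → g 0 < A → v ≤ N → A + suc c ≤ g v →
             c ≤ count (λ r → between A (A + suc c) (g r)) (suc N)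
  crossing {v} low-0 v≤N high-v with least-below (λ r → A + suc c ≤? g r) (suc v)
  ... | inj₁ none = contradiction high-v (none v ≤-refl)
  ... | inj₂ (y , y<1+v , high-y , below-y)
    with greatest-below (λ r → g r <? A) y low-0
           (≤∧≢⇒< z≤n λ { refl → <⇒≱ low-0 (≤-trans (m≤m+n A (suc c)) high-y) })
  ...   | x , _ , x<y , low-x , above-x =
    mid-run x<y (≤-trans (s≤s⁻¹ y<1+v) v≤N) low-x high-y
      λ r x<r r<y → between-intro (≮⇒≥ (above-x r x<r r<y)) (≰⇒> (below-y r r<y))

-- Lengths of threshold counts
maxUpTo : (ℕ → ℕ) → ℕ → ℕ
maxUpTo g zero    = 0
maxUpTo g (suc t) = g t ⊔ maxUpTo g t

maxUpTo-upper : ∀ g {t r} → r < t → g r ≤ maxUpTo g t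
maxUpTo-upper g {suc t} {r} r<1+t with m<1+n⇒m<n∨m≡n r<1+t
... | inj₁ r<t = m≤n⇒m≤o⊔n (g t) (maxUpTo-upper g r<t)
... | inj₂ refl = m≤m⊔n (g t) (maxUpTo g t)

maxUpTo-attained : ∀ g t {p} → 1 ≤ p → p ≤ maxUpTo g t → ∃[ r ] (r < t × p ≤ g r)
maxUpTo-attained g zero    1≤p p≤0 = contradiction (≤-trans 1≤p p≤0) λ ()
maxUpTo-attained g (suc t) 1≤p p≤max with ⊔-sel (g t) (maxUpTo g t)
... | inj₁ max≡g = t , ≤-refl , subst (_ ≤_) max≡g p≤max
... | inj₂ max≡m with maxUpTo-attained g t 1≤p (subst (_ ≤_) max≡m p≤max)
...   | r , r<t , p≤g = r , m<n⇒m<1+n r<t , p≤g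

threshold-count-length : ∀ g c t →
  HasLength (λ k → count (λ r → suc (c + k) ≤ᵇ g r) t) (maxUpTo g t ∸ c)
threshold-count-length g c t k = nonzero , zero-beyond
  where
  max = maxUpTo g t
  reach : k < max ∸ c → suc (c + k) ≤ max
  reach k<max∸c = begin
    suc (c + k)   ≡⟨ cong suc (+-comm c k) ⟩
    suc k + c     ≤⟨ m≤o∸n⇒m+n≤o (suc k) (<⇒≤ (m∸n≢0⇒n<m (m<n⇒n≢0 k<max∸c))) k<max∸c ⟩
    max           ∎
    where open ≤-Reasoning
  nonzero : k < max ∸ c → count (λ r → suc (c + k) ≤ᵇ g r) t ≢ 0
  nonzero k<max∸c with maxUpTo-attained g t (s≤s z≤n) (reach k<max∸c)
  ... | r , r<t , high = m<n⇒n≢0 (count-pos _ r<t (≤⇒≤ᵇ high))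
  zero-beyond : max ∸ c ≤ k → count (λ r → suc (c + k) ≤ᵇ g r) t ≡ 0
  zero-beyond max∸c≤k = n≤0⇒n≡0 (subst (count (λ r → suc (c + k) ≤ᵇ g r) t ≤_) (n∸n≡0 t)
    (count-≤-∸-prefix _ t t λ r r<t _ high → <⇒≱ (s≤s (below r<t)) (≤ᵇ⇒≤ _ _ high)))
    where
    below : ∀ {r} → r < t → g r ≤ c + k
    below r<t = ≤-trans (maxUpTo-upper g r<t) (≤-trans (m≤n+m∸n max c) (+-monoʳ-≤ c max∸c≤k))

-- Energies modulo the period
module _ where
  open import Data.Integer as ℤ using (ℤ; +_; -[1+_]; _%ℕ_; _/ℕ_; +<+; +≤+)
  import Data.Integer.Properties as ℤ
  open import Data.Integer.DivMod using (a≡a%ℕn+[a/ℕn]*n; n%ℕd<d)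
  open import Data.Integer.Tactic.RingSolver using () renaming (solve-∀ to solve-∀ℤ)

  private
    cancel-+ˡ : ∀ (i x : ℤ) → ℤ.- i ℤ.+ (i ℤ.+ x) ≡ x
    cancel-+ˡ = solve-∀ℤ

    +-difference : ∀ (i j : ℤ) → j ≡ i ℤ.+ (j ℤ.- i)
    +-difference = solve-∀ℤ

  ℤ-gap : ∀ {i j : ℤ} {t} → i ℤ.< j → j ℤ.≤ i ℤ.+ + t → ∃[ d ] (1 ≤ d × d ≤ t × j ≡ i ℤ.+ + d)
  ℤ-gap {i} {j} {t} i<j j≤i+t = gap (j ℤ.- i) (+-difference i j)
    where
    gap : ∀ D → j ≡ i ℤ.+ D → ∃[ d ] (1 ≤ d × d ≤ t × j ≡ i ℤ.+ + d)
    gap D refl with subst₂ ℤ._<_ (cancel-+ˡ i (+ 0)) (cancel-+ˡ i D)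
                      (ℤ.+-monoʳ-< (ℤ.- i) (subst (ℤ._< i ℤ.+ D) (sym (ℤ.+-identityʳ i)) i<j))
    gap (+ zero)  refl | +<+ ()
    gap -[1+ _ ]  refl | ()
    gap (+ suc d) refl | _ = suc d , s≤s z≤n ,
      ℤ.drop‿+≤+ (subst₂ ℤ._≤_ (cancel-+ˡ i (+ suc d)) (cancel-+ˡ i (+ t)) (ℤ.+-monoʳ-≤ (ℤ.- i) j≤i+t)) , refl

  private
    shift-out : ∀ (A D K M : ℤ) → A ℤ.+ D ≡ (A ℤ.+ K ℤ.* M ℤ.+ D) ℤ.- K ℤ.* M
    shift-out = solve-∀ℤ

    collect : ∀ (B K K′ M : ℤ) → (B ℤ.+ K′ ℤ.* M) ℤ.- K ℤ.* M ≡ B ℤ.+ (K′ ℤ.- K) ℤ.* M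
    collect = solve-∀ℤ

    add-back : ∀ (B K M : ℤ) → B ≡ (B ℤ.+ K ℤ.* M) ℤ.+ (ℤ.- K) ℤ.* M
    add-back = solve-∀ℤ

    quotient-nonneg : ∀ {m} a b (K : ℤ) → b < m → + a ≡ + b ℤ.+ K ℤ.* + m → ∃[ q ] a ≡ b + q * m
    quotient-nonneg {m} a b (+ q) _ eq =
      q , ℤ.+-injective (trans eq (trans (cong (λ z → + b ℤ.+ z) (sym (ℤ.pos-* q m))) (sym (ℤ.pos-+ b (q * m)))))
    quotient-nonneg {m} a b -[1+ p ] b<m eq = contradiction b<m (≤⇒≯ (let open ≤-Reasoning in begin
      m                   ≤⟨ m≤m+n m (p * m) ⟩
      suc p * m           ≤⟨ m≤n+m (suc p * m) a ⟩
      a + suc p * m       ≡⟨ ℤ.+-injective b≡ ⟨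
      b                   ∎))
      where
      b≡ : + b ≡ + (a + suc p * m)
      b≡ = let open ≡-Reasoning in begin
        + b                                           ≡⟨ add-back (+ b) -[1+ p ] (+ m) ⟩
        (+ b ℤ.+ -[1+ p ] ℤ.* + m) ℤ.+ + suc p ℤ.* + m ≡⟨ cong₂ ℤ._+_ (sym eq) (sym (ℤ.pos-* (suc p) m)) ⟩
        + a ℤ.+ + (suc p * m)                         ≡⟨ ℤ.pos-+ a (suc p * m) ⟨
        + (a + suc p * m)                             ∎

  %ℕ-shift : ∀ (x : ℤ) d m .{{_ : NonZero m}} → ∃[ q ] x %ℕ m + d ≡ (x ℤ.+ + d) %ℕ m + q * m
  %ℕ-shift x d m = quotient-nonneg _ _ (k′ ℤ.- k) (n%ℕd<d (x ℤ.+ + d) m) (begin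
    + (x %ℕ m + d)                                  ≡⟨ ℤ.pos-+ (x %ℕ m) d ⟩
    + (x %ℕ m) ℤ.+ + d                              ≡⟨ shift-out (+ (x %ℕ m)) (+ d) k (+ m) ⟩
    (+ (x %ℕ m) ℤ.+ k ℤ.* + m ℤ.+ + d) ℤ.- k ℤ.* + m ≡⟨ cong (λ z → (z ℤ.+ + d) ℤ.- k ℤ.* + m) (a≡a%ℕn+[a/ℕn]*n x m) ⟨
    (x ℤ.+ + d) ℤ.- k ℤ.* + m                       ≡⟨ cong (ℤ._- k ℤ.* + m) (a≡a%ℕn+[a/ℕn]*n (x ℤ.+ + d) m) ⟩
    (+ r′ ℤ.+ k′ ℤ.* + m) ℤ.- k ℤ.* + m              ≡⟨ collect (+ r′) k k′ (+ m) ⟩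
    + r′ ℤ.+ (k′ ℤ.- k) ℤ.* + m                      ∎)
    where
    open ≡-Reasoning
    k = x /ℕ m
    k′ = (x ℤ.+ + d) /ℕ m
    r′ = (x ℤ.+ + d) %ℕ m

  residue-cases : ∀ {a b d q m} → 1 ≤ d → a + d ≡ b + q * m →
                  (a < b × b ≤ a + d) ⊎ (b ≤ a × b + m ≤ a + d)
  residue-cases {a} {b} {d} {zero} 1≤d eq =
    inj₁ (subst (a <_) b≡ (m<m+n a 1≤d) , ≤-reflexive (sym b≡))
    where b≡ : a + d ≡ b
          b≡ = trans eq (+-identityʳ b)
  residue-cases {a} {b} {d} {suc q} {m} _ eq with a <? b
  ... | yes a<b = inj₁ (a<b , ≤-trans (m≤m+n b _) (≤-reflexive (sym eq)))
  ... | no  a≮b = inj₂ (≮⇒≥ a≮b , ≤-trans (+-monoʳ-≤ b (m≤m+n m (q * m))) (≤-reflexive (sym eq)))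

  -- energy ν m (+ suc x) computes to ν (x % m) + x % m.
  energy-step⇒residue-step : ∀ (ν : Conf) m s .{{_ : NonZero m}} →
    (∀ i j → i ℤ.< j → j ℤ.≤ i ℤ.+ + s → energy ν m j ≤ energy ν m i + 1) →
    ∀ {x y} → x < y → y ≤ x + s → ν (y % m) + y % m ≤ ν (x % m) + x % m + 1
  energy-step⇒residue-step ν m s step x<y y≤x+s = step (+ suc _) (+ suc _) (+<+ (s≤s x<y)) (+≤+ (s≤s y≤x+s))

  private
    -1-+ : ∀ (i D : ℤ) → (i ℤ.- + 1) ℤ.+ D ≡ (i ℤ.+ D) ℤ.- + 1
    -1-+ = solve-∀ℤ

  residue-steps⇒energy-step : ∀ (ν : Conf) m t .{{_ : NonZero m}} →
    (∀ {a b} → a < b → b < m → b ≤ a + t → ν b + b ≤ ν a + a + 1) →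
    (∀ {a b} → b ≤ a → a < m → b + m ≤ a + t → ν b + b ≤ ν a + a + 1) →
    ∀ i j → i ℤ.< j → j ℤ.≤ i ℤ.+ + t → energy ν m j ≤ energy ν m i + 1
  residue-steps⇒energy-step ν m t forward wrap i j i<j j≤i+t with ℤ-gap i<j j≤i+t
  ... | d , 1≤d , d≤t , refl rewrite sym (-1-+ i (+ d))
    with %ℕ-shift (i ℤ.- + 1) d m | n%ℕd<d (i ℤ.- + 1) m | n%ℕd<d ((i ℤ.- + 1) ℤ.+ + d) m
  ... | q , eq | a<m | b<m with residue-cases {q = q} 1≤d eq
  ... | inj₁ (a<b , b≤a+d)   = forward a<b b<m (≤-trans b≤a+d (+-monoʳ-≤ _ d≤t))
  ... | inj₂ (b≤a , b+m≤a+d) = wrap b≤a a<m (≤-trans b+m≤a+d (+-monoʳ-≤ _ d≤t))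

-- Configurations and the move Φ
<-⊔⁻ : ∀ {x} y z → x < y ⊔ z → ¬ x < z → x < y
<-⊔⁻ y z x<y⊔z x≮z with ⊔-sel y z
... | inj₁ y⊔z≡y = subst (_ <_) y⊔z≡y x<y⊔z
... | inj₂ y⊔z≡z = contradiction (subst (_ <_) y⊔z≡z x<y⊔z) x≮z

HasLength-unique : ∀ {ν a b} → HasLength ν a → HasLength ν b → a ≡ b
HasLength-unique {ν} {a} {b} len-a len-b with <-cmp a b
... | tri< a<b _ _ = contradiction (proj₂ (len-a a) ≤-refl) (proj₁ (len-b a) a<b)
... | tri≈ _ a≡b _ = a≡b
... | tri> _ _ b<a = contradiction (proj₂ (len-b b) ≤-refl) (proj₁ (len-a b) b<a)

HasLength-cong : ∀ {ν ν′ ℓ} → (∀ k → ν k ≡ ν′ k) → HasLength ν′ ℓ → HasLength ν ℓ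
HasLength-cong ν≗ν′ len k = (λ k<ℓ → subst (_≢ 0) (sym (ν≗ν′ k)) (proj₁ (len k) k<ℓ))
                          , (λ ℓ≤k → trans (ν≗ν′ k) (proj₂ (len k) ℓ≤k))

Φ-step : ∀ ν k → Φ ν k ≡ ν (suc k) + indicator (k <ᵇ ν 0)
Φ-step ν k with k <ᵇ ν 0
... | true  = +-comm 1 (ν (suc k))
... | false = sym (+-identityʳ (ν (suc k)))

<ᵇ-cancelˡ : ∀ t k m → (t + k <ᵇ t + m) ≡ (k <ᵇ m)
<ᵇ-cancelˡ zero    k m = refl
<ᵇ-cancelˡ (suc t) k m = <ᵇ-cancelˡ t k m

module AboveMarching {λ′ : Conf} {n : ℕ} (len : HasLength λ′ n) (march : M n ≤C λ′) where

  e : ℕ → ℕ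
  e r = λ′ r + r

  G : ℕ → ℕ
  G r = r + e r

  n≤e : ∀ r → n ≤ e r
  n≤e r = begin
    n             ≤⟨ m≤n+m∸n n r ⟩
    r + (n ∸ r)   ≡⟨ +-comm r (n ∸ r) ⟩
    (n ∸ r) + r   ≤⟨ +-monoˡ-≤ r (march r) ⟩
    e r           ∎
    where open ≤-Reasoning

  G-above : ∀ {a r} → a < r → suc n + a ≤ G r
  G-above {a} {r} a<r = begin
    suc n + a   ≡⟨ cong suc (+-comm n a) ⟩
    suc a + n   ≤⟨ +-mono-≤ a<r (n≤e r) ⟩
    G r         ∎
    where open ≤-Reasoning

  G-at-n : G n ≡ n + n
  G-at-n = cong (n +_) (cong (_+ n) (proj₂ (len n) ≤-refl))

  count-early-piles : ∀ t → t ≤ n → count (λ r → t ≤ᵇ G r) t ≡ t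
  count-early-piles t t≤n = ≤-antisym (count≤ _ t) (count-≥-window _ 0 t ≤-refl
    λ r _ r<t → ≤⇒≤ᵇ (≤-trans t≤n (≤-trans (m≤n+m n r) (+-monoʳ-≤ r (n≤e r)))))

  Φ^-formula : ∀ t → t ≤ suc n → ∀ k → Φ^ t λ′ k ≡ λ′ (t + k) + count (λ r → t + k ≤ᵇ G r) t
  Φ^-formula zero    _      k = sym (+-identityʳ (λ′ k))
  Φ^-formula (suc t) 1+t≤1+n k = begin
    Φ (Φ^ t λ′) k
      ≡⟨ Φ-step (Φ^ t λ′) k ⟩
    Φ^ t λ′ (suc k) + indicator (k <ᵇ Φ^ t λ′ 0)
      ≡⟨ cong₂ _+_ (Φ^-formula t t≤1+n (suc k)) (cong (λ x → indicator (k <ᵇ x)) first-pile) ⟩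
    λ′ (t + suc k) + count (λ r → t + suc k ≤ᵇ G r) t + indicator (k <ᵇ e t)
      ≡⟨ cong₂ (λ p b → λ′ p + count (λ r → p ≤ᵇ G r) t + indicator b) (+-suc t k) (sym (<ᵇ-cancelˡ t k (e t))) ⟩
    λ′ (suc t + k) + count (λ r → suc t + k ≤ᵇ G r) t + indicator (suc t + k ≤ᵇ G t)
      ≡⟨ +-assoc (λ′ (suc t + k)) _ _ ⟩
    λ′ (suc t + k) + (count (λ r → suc t + k ≤ᵇ G r) t + indicator (suc t + k ≤ᵇ G t))
      ≡⟨ cong (λ′ (suc t + k) +_) (+-comm (count (λ r → suc t + k ≤ᵇ G r) t) _) ⟩
    λ′ (suc t + k) + count (λ r → suc t + k ≤ᵇ G r) (suc t) ∎
    where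
    open ≡-Reasoning
    t≤1+n : t ≤ suc n
    t≤1+n = m≤n⇒m≤1+n (s≤s⁻¹ 1+t≤1+n)
    first-pile : Φ^ t λ′ 0 ≡ e t
    first-pile = begin
      Φ^ t λ′ 0                                          ≡⟨ Φ^-formula t t≤1+n 0 ⟩
      λ′ (t + 0) + count (λ r → t + 0 ≤ᵇ G r) t          ≡⟨ cong (λ p → λ′ p + count (λ r → p ≤ᵇ G r) t) (+-identityʳ t) ⟩
      λ′ t + count (λ r → t ≤ᵇ G r) t                    ≡⟨ cong (λ′ t +_) (count-early-piles t (s≤s⁻¹ 1+t≤1+n)) ⟩
      e t                                                ∎

  μ : Conf
  μ = Φ^ (suc n) λ′

  above : ℕ → ℕ
  above p = count (λ r → p ≤ᵇ G r) (suc n)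

  μ-formula : ∀ k → μ k ≡ above (suc n + k)
  μ-formula k = trans (Φ^-formula (suc n) ≤-refl k)
    (cong (_+ above (suc n + k)) (proj₂ (len (suc n + k)) (≤-trans (n≤1+n n) (m≤m+n (suc n) k))))

  L : ℕ
  L = maxUpTo G (suc n) ∸ n

  μ-length : HasLength μ L
  μ-length = HasLength-cong μ-formula (threshold-count-length G n (suc n))

  n+n≤max : n + n ≤ maxUpTo G (suc n)
  n+n≤max = subst (_≤ maxUpTo G (suc n)) G-at-n (maxUpTo-upper G {r = n} ≤-refl)

  n≤L : n ≤ L
  n≤L = subst (_≤ L) (m+n∸n≡m n n) (∸-monoˡ-≤ n n+n≤max)

  μ≤ : ∀ k → μ k ≤ suc n
  μ≤ k = subst (_≤ suc n) (sym (μ-formula k)) (count≤ _ (suc n))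

  μ-≥-window : ∀ a u → u ≤ suc n → (∀ r → u ≤ r → r ≤ n → suc n + a ≤ G r) → suc n ∸ u ≤ μ a
  μ-≥-window a u u≤1+n high = subst (suc n ∸ u ≤_) (sym (μ-formula a))
    (count-≥-window _ u (suc n ∸ u) (≤-reflexive u+[1+n∸u]≡1+n)
      λ r u≤r r<u+[1+n∸u] → ≤⇒≤ᵇ (high r u≤r (s≤s⁻¹ (subst (r <_) u+[1+n∸u]≡1+n r<u+[1+n∸u]))))
    where u+[1+n∸u]≡1+n = m+[n∸m]≡n u≤1+n

  μ-≤-prefix : ∀ k c → (∀ r → r < c → r ≤ n → G r < suc n + k) → μ k ≤ suc n ∸ c
  μ-≤-prefix k c low = subst (_≤ suc n ∸ c) (sym (μ-formula k))
    (count-≤-∸-prefix _ c (suc n) λ r r<c r<1+n high → <⇒≱ (low r r<c (s≤s⁻¹ r<1+n)) (≤ᵇ⇒≤ _ _ high))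

  μ0≤n : λ′ 0 ≤ n → μ 0 ≤ n
  μ0≤n λ0≤n = μ-≤-prefix 0 1 λ { zero _ _ → s≤s (+-monoˡ-≤ 0 λ0≤n) ; (suc _) (s≤s ()) _ }

  μ0-full : suc n ≤ λ′ 0 → suc n ≤ μ 0
  μ0-full n<λ0 = μ-≥-window 0 0 z≤n λ { zero _ _ → +-monoˡ-≤ 0 n<λ0 ; (suc r) _ _ → G-above {r = suc r} (s≤s z≤n) }

  n≤μ-energy : ∀ a → n ≤ μ a + a
  n≤μ-energy a with a <? n
  ... | no  a≮n = ≤-trans (≮⇒≥ a≮n) (m≤n+m a (μ a))
  ... | yes a<n = subst (_≤ μ a + a) (m∸n+n≡m (<⇒≤ a<n))
                    (+-monoˡ-≤ a (μ-≥-window a (suc a) (s≤s (<⇒≤ a<n)) λ r a<r _ → G-above a<r))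

  μ-energy-full : ∀ {a} → a ≤ n → suc n ≤ e a → suc n ≤ μ a + a
  μ-energy-full {a} a≤n n<ea = subst (_≤ μ a + a) (m∸n+n≡m (m≤n⇒m≤1+n a≤n))
    (+-monoˡ-≤ a (μ-≥-window a a (m≤n⇒m≤1+n a≤n) high))
    where
    high : ∀ r → a ≤ r → r ≤ n → suc n + a ≤ G r
    high r a≤r _ with m≤n⇒m<n∨m≡n a≤r
    ... | inj₁ a<r  = G-above a<r
    ... | inj₂ refl = subst (_≤ G a) (+-comm a (suc n)) (+-monoʳ-≤ a n<ea)

  module StepBound {s : ℕ} (1≤n : 1 ≤ n) (mono : 1 ≤ s → MonoCond s λ′ n) where

    m : ℕ
    m = λ′ 0 ⊔ n

    instance
      m-nonZero : NonZero m
      m-nonZero = >-nonZero (≤-trans 1≤n (m≤n⊔m (λ′ 0) n))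

    e-step : 1 ≤ s → ∀ {x y} → x < y → y ≤ x + s → e (y % m) ≤ e (x % m) + 1
    e-step 1≤s = energy-step⇒residue-step λ′ m s (proj₂ (mono 1≤s) m-nonZero)

    λ0≤1+n : 1 ≤ s → λ′ 0 ≤ suc n
    λ0≤1+n 1≤s = subst (λ′ 0 ≤_) (+-comm n 1) (proj₁ (mono 1≤s))

    G0≤1+n : 1 ≤ s → G 0 ≤ suc n
    G0≤1+n 1≤s = subst (_≤ suc n) (sym (+-identityʳ (λ′ 0))) (λ0≤1+n 1≤s)

    -- For r + j < m this is e_{r+j} ≤ e_r + 1; otherwise r + j = n, where G n = 2n is small.
    G-jump : JumpBound G s n
    G-jump r j 1≤j j≤s r+j≤n with r + j <? m
    ... | yes r+j<m = begin
      r + j + e (r + j)    ≤⟨ +-monoʳ-≤ (r + j) step ⟩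
      r + j + (e r + 1)    ≡⟨ rearrange r j (e r) ⟩
      G r + suc j          ∎
      where
      open ≤-Reasoning
      rearrange : ∀ r j x → r + j + (x + 1) ≡ r + x + suc j
      rearrange = solve-∀
      step : e (r + j) ≤ e r + 1
      step = subst₂ (λ y x → e y ≤ e x + 1) (m<n⇒m%n≡m r+j<m) (m<n⇒m%n≡m (≤-<-trans (m≤m+n r j) r+j<m))
               (e-step (≤-trans 1≤j j≤s) (m<m+n r 1≤j) (+-monoʳ-≤ r j≤s))
    ... | no r+j≮m = begin
      G (r + j)             ≡⟨ cong G r+j≡n ⟩
      G n                   ≡⟨ G-at-n ⟩
      n + n                 ≤⟨ +-monoʳ-≤ n (n≤1+n n) ⟩
      n + suc n             ≡⟨ cong (λ x → n + suc x) (sym r+j≡n) ⟩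
      n + suc (r + j)       ≡⟨ rearrange n r j ⟩
      r + n + suc j         ≤⟨ +-monoˡ-≤ (suc j) (+-monoʳ-≤ r (n≤e r)) ⟩
      G r + suc j           ∎
      where
      open ≤-Reasoning
      rearrange : ∀ n r j → n + suc (r + j) ≡ r + n + suc j
      rearrange = solve-∀
      r+j≡n : r + j ≡ n
      r+j≡n = ≤-antisym r+j≤n (≤-trans (m≤n⊔m (λ′ 0) n) (≮⇒≥ r+j≮m))

    -- A virtual pile in front of G, below every threshold suc n + a; the jump bound
    -- survives the extension because λ₀ ≤ n + 1.
    H : ℕ → ℕ
    H zero    = n
    H (suc r) = G r

    H-jump : JumpBound H s (suc n)
    H-jump zero (suc zero) _ 1≤s _ = ≤-trans (G0≤1+n 1≤s) (subst (suc n ≤_) (+-comm 2 n) (n≤1+n (suc n)))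
    H-jump zero (suc (suc j)) _ 2+j≤s 2+j≤1+n = begin
      G (suc j)                  ≤⟨ G-jump 0 (suc j) (s≤s z≤n) (≤-trans (n≤1+n _) 2+j≤s) (s≤s⁻¹ 2+j≤1+n) ⟩
      G 0 + suc (suc j)          ≤⟨ +-monoˡ-≤ (suc (suc j)) (G0≤1+n (≤-trans (s≤s z≤n) 2+j≤s)) ⟩
      suc n + suc (suc j)        ≡⟨ +-suc n (suc (suc j)) ⟨
      n + suc (suc (suc j))      ∎
      where open ≤-Reasoning
    H-jump (suc r) j 1≤j j≤s r+j≤n = G-jump r j 1≤j j≤s (s≤s⁻¹ r+j≤n)

    e-wrap : 1 ≤ s → ∀ {a b} → a < m → b < m → m + b ≤ a + s → e b ≤ e a + 1
    e-wrap 1≤s {a} {b} a<m b<m m+b≤a+s =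
      subst₂ (λ y x → e y ≤ e x + 1) [m+b]%m≡b (m<n⇒m%n≡m a<m)
        (e-step 1≤s (<-≤-trans a<m (m≤m+n m b)) m+b≤a+s)
      where
      [m+b]%m≡b : (m + b) % m ≡ b
      [m+b]%m≡b = trans (cong (_% m) (+-comm m b)) (trans ([m+n]%n≡m%n b m) (m<n⇒m%n≡m b<m))

    -- μ a − μ (a + suc c) counts the piles with G in [A, A + suc c); crossing on H finds c of them.
    μ-drop : ∀ a c → c ≤ s → suc n + (a + suc c) ≤ maxUpTo G (suc n) → c + μ (a + suc c) ≤ μ a
    μ-drop a c c≤s high with maxUpTo-attained G (suc n) (s≤s z≤n) high
    ... | r , r<1+n , high-r = begin
      c + μ (a + suc c)                ≤⟨ +-monoˡ-≤ _ crossed ⟩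
      count mid (suc n) + μ (a + suc c) ≡⟨ cong (count mid (suc n) +_) (trans (μ-formula (a + suc c)) (cong above (sym B≡))) ⟩
      count mid (suc n) + above B      ≡⟨ +-comm _ (above B) ⟩
      above B + count mid (suc n)      ≡⟨ count-split _ _ (suc n) A≤ ⟨
      above A                          ≡⟨ μ-formula a ⟨
      μ a                              ∎
      where
      open ≤-Reasoning
      A = suc n + a
      B = A + suc c
      B≡ : B ≡ suc n + (a + suc c)
      B≡ = +-assoc (suc n) a (suc c)
      mid : ℕ → Bool
      mid r = between A B (G r)
      A≤ : ∀ r → T (B ≤ᵇ G r) → T (A ≤ᵇ G r)
      A≤ r B≤G = ≤⇒≤ᵇ (≤-trans (m≤m+n A (suc c)) (≤ᵇ⇒≤ B (G r) B≤G))
      crossed : c ≤ count mid (suc n)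
      crossed = subst (c ≤_) (count-shift (λ r → between A B (H r)) (suc n) (between-below (s≤s (m≤m+n n a))))
        (crossing H-jump c≤s (s≤s (m≤m+n n a)) r<1+n (subst (_≤ G r) (sym B≡) high-r))

    m′ : ℕ
    m′ = μ 0 ⊔ L

    m≤m′ : 1 ≤ s → m ≤ m′
    m≤m′ 1≤s = ⊔-lub λ0≤m′ (≤-trans n≤L (m≤n⊔m (μ 0) L))
      where
      λ0≤m′ : λ′ 0 ≤ m′
      λ0≤m′ with λ′ 0 ≤? n
      ... | yes λ0≤n = ≤-trans λ0≤n (≤-trans n≤L (m≤n⊔m (μ 0) L))
      ... | no  λ0≰n = ≤-trans (λ0≤1+n 1≤s) (≤-trans (μ0-full (≰⇒> λ0≰n)) (m≤m⊔n (μ 0) L))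

    μ-step-forward : ∀ {a b} → a < b → b < m′ → b ≤ a + suc s → μ b + b ≤ μ a + a + 1
    μ-step-forward {a} {b} a<b b<m′ b≤a+1+s with b <? L
    ... | no b≮L = begin
      μ b + b       ≡⟨ cong (_+ b) (proj₂ (μ-length b) (≮⇒≥ b≮L)) ⟩
      b             ≤⟨ s≤s⁻¹ (≤-trans (<-⊔⁻ (μ 0) L b<m′ b≮L) (μ≤ 0)) ⟩
      n             ≤⟨ n≤μ-energy a ⟩
      μ a + a       ≤⟨ m≤m+n _ 1 ⟩
      μ a + a + 1   ∎
      where open ≤-Reasoning
    ... | yes b<L with m≤n⇒∃[o]m+o≡n a<b
    ...   | c , refl = begin
      μ (suc a + c) + (suc a + c)         ≡⟨ cong (λ b → μ b + b) (+-suc a c) ⟨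
      μ (a + suc c) + (a + suc c)         ≡⟨ rearrange (μ (a + suc c)) a c ⟩
      c + μ (a + suc c) + a + 1           ≤⟨ +-monoˡ-≤ 1 (+-monoˡ-≤ a (μ-drop a c c≤s high)) ⟩
      μ a + a + 1                         ∎
      where
      open ≤-Reasoning
      rearrange : ∀ x a c → x + (a + suc c) ≡ c + x + a + 1
      rearrange = solve-∀
      c≤s : c ≤ s
      c≤s = s≤s⁻¹ (+-cancelˡ-≤ a (suc c) (suc s) (subst (_≤ a + suc s) (sym (+-suc a c)) b≤a+1+s))
      high : suc n + (a + suc c) ≤ maxUpTo G (suc n)
      high = begin
        suc n + (a + suc c)   ≡⟨ cong (suc n +_) (+-suc a c) ⟩
        suc n + (suc a + c)   ≡⟨ cong suc (+-comm n (suc a + c)) ⟩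
        suc (suc a + c) + n   ≤⟨ m≤o∸n⇒m+n≤o (suc (suc a + c)) (≤-trans (m≤m+n n n) n+n≤max) b<L ⟩
        maxUpTo G (suc n)     ∎

    wrap-energy-lower : 1 ≤ s → ∀ {a b} → b < n → a < m′ → suc b + m′ ≤ a + suc s →
                  suc (suc n) ≤ e b → suc n ≤ μ a + a
    wrap-energy-lower 1≤s {a} {b} b<n a<m′ bound 2+n≤eb with n <? a
    ... | yes n<a = ≤-trans n<a (m≤n+m a (μ a))
    ... | no  n≮a with a <? m
    ...   | yes a<m = μ-energy-full (≮⇒≥ n≮a)
              (s≤s⁻¹ (≤-trans 2+n≤eb (subst (e b ≤_) (+-comm (e a) 1) (e-wrap 1≤s a<m b<m m+b≤a+s))))
      where
      b<m : b < m
      b<m = <-≤-trans b<n (m≤n⊔m (λ′ 0) n)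
      m+b≤a+s : m + b ≤ a + s
      m+b≤a+s = begin
        m + b     ≤⟨ +-monoˡ-≤ b (m≤m′ 1≤s) ⟩
        m′ + b    ≡⟨ +-comm m′ b ⟩
        b + m′    ≤⟨ s≤s⁻¹ (subst (suc b + m′ ≤_) (+-suc a s) bound) ⟩
        a + s     ∎
        where open ≤-Reasoning
    ...   | no  a≮m = subst (λ x → suc x ≤ μ a + a) a≡n (+-monoˡ-≤ a (n≢0⇒n>0 (proj₁ (μ-length a) a<L)))
      where
      a≡n : a ≡ n
      a≡n = ≤-antisym (≮⇒≥ n≮a) (≤-trans (m≤n⊔m (λ′ 0) n) (≮⇒≥ a≮m))
      λ0≤n : λ′ 0 ≤ n
      λ0≤n = ≤-trans (m≤m⊔n (λ′ 0) n) (≤-trans (≮⇒≥ a≮m) (≮⇒≥ n≮a))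
      a<L : a < L
      a<L = <-⊔⁻ L (μ 0) (subst (a <_) (⊔-comm (μ 0) L) a<m′)
              (λ a<μ0 → <⇒≱ a<μ0 (subst (μ 0 ≤_) (sym a≡n) (μ0≤n λ0≤n)))

    wrap-gap<s : ∀ {a b} → a < m′ → suc b + m′ ≤ a + suc s → b < s
    wrap-gap<s {a} {b} a<m′ bound = s≤s⁻¹ (+-cancelʳ-< m′ (suc b) (suc s) (begin-strict
      suc b + m′    ≤⟨ bound ⟩
      a + suc s     <⟨ +-monoˡ-< (suc s) a<m′ ⟩
      m′ + suc s    ≡⟨ +-comm m′ (suc s) ⟩
      suc s + m′    ∎))
      where open ≤-Reasoning

    G-early : ∀ {b} → b < s → ∀ r → r < b → r ≤ n → G r < suc n + suc b
    G-early {b} b<s r r<b r≤n = begin-strict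
      G r               ≤⟨ H-jump 0 (suc r) (s≤s z≤n) (≤-trans r<b (<⇒≤ b<s)) (s≤s r≤n) ⟩
      n + suc (suc r)   ≤⟨ +-monoʳ-≤ n (s≤s r<b) ⟩
      n + suc b         <⟨ ≤-refl ⟩
      suc n + suc b     ∎
      where open ≤-Reasoning

    -- Piles r < b fall short of suc n + suc b, so μ (suc b) ≤ suc n ∸ b; if pile b reaches
    -- that threshold, the missing unit comes from the cyclic monotonicity of λ.
    μ-step-wrap : ∀ {a b} → b ≤ a → a < m′ → b + m′ ≤ a + suc s → μ b + b ≤ μ a + a + 1
    μ-step-wrap {a} {zero} _ _ _ = begin
      μ 0 + 0       ≡⟨ +-identityʳ (μ 0) ⟩
      μ 0           ≤⟨ μ≤ 0 ⟩
      suc n         ≡⟨ +-comm 1 n ⟩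
      n + 1         ≤⟨ +-monoˡ-≤ 1 (n≤μ-energy a) ⟩
      μ a + a + 1   ∎
      where open ≤-Reasoning
    μ-step-wrap {a} {suc b} 1+b≤a a<m′ bound with wrap-gap<s a<m′ bound | n ≤? b
    ... | b<s | yes n≤b = begin
      μ (suc b) + suc b       ≤⟨ +-monoˡ-≤ (suc b) (μ-≤-prefix (suc b) b (G-early b<s)) ⟩
      (suc n ∸ b) + suc b     ≤⟨ +-monoˡ-≤ (suc b) (∸-monoʳ-≤ (suc n) n≤b) ⟩
      (suc n ∸ n) + suc b     ≡⟨ cong (_+ suc b) (m+n∸n≡m 1 n) ⟩
      suc (suc b)             ≤⟨ s≤s 1+b≤a ⟩
      suc a                   ≡⟨ +-comm 1 a ⟩
      a + 1                   ≤⟨ +-monoˡ-≤ 1 (m≤n+m a (μ a)) ⟩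
      μ a + a + 1             ∎
      where open ≤-Reasoning
    ... | b<s | no n≰b with suc n + suc b ≤? G b
    ...   | no low-b = begin
      μ (suc b) + suc b       ≤⟨ +-monoˡ-≤ (suc b) (μ-≤-prefix (suc b) (suc b) G-early′) ⟩
      (n ∸ b) + suc b         ≡⟨ +-suc (n ∸ b) b ⟩
      suc (n ∸ b + b)         ≡⟨ cong suc (m∸n+n≡m (≰⇒≥ n≰b)) ⟩
      suc n                   ≡⟨ +-comm 1 n ⟩
      n + 1                   ≤⟨ +-monoˡ-≤ 1 (n≤μ-energy a) ⟩
      μ a + a + 1             ∎
      where
      open ≤-Reasoning
      G-early′ : ∀ r → r < suc b → r ≤ n → G r < suc n + suc b
      G-early′ r r<1+b r≤n with m<1+n⇒m<n∨m≡n r<1+b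
      ... | inj₁ r<b  = G-early b<s r r<b r≤n
      ... | inj₂ refl = ≰⇒> low-b
    ...   | yes high-b = begin
      μ (suc b) + suc b       ≤⟨ +-monoˡ-≤ (suc b) (μ-≤-prefix (suc b) b (G-early b<s)) ⟩
      (suc n ∸ b) + suc b     ≡⟨ +-suc (suc n ∸ b) b ⟩
      suc (suc n ∸ b + b)     ≡⟨ cong suc (m∸n+n≡m (m≤n⇒m≤1+n (≰⇒≥ n≰b))) ⟩
      suc (suc n)             ≡⟨ +-comm 1 (suc n) ⟩
      suc n + 1               ≤⟨ +-monoˡ-≤ 1 (wrap-energy-lower (≤-trans (s≤s z≤n) b<s) (≰⇒> n≰b) a<m′ bound 2+n≤eb) ⟩
      μ a + a + 1             ∎
      where
      open ≤-Reasoning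
      rearrange : ∀ n b → suc n + suc b ≡ b + suc (suc n)
      rearrange = solve-∀
      2+n≤eb : suc (suc n) ≤ e b
      2+n≤eb = +-cancelˡ-≤ b _ _ (subst (_≤ G b) (rearrange n b) high-b)

    μ-monotone : Monotone (suc s) μ
    μ-monotone = (L , μ-length) , inj₂ (s≤s z≤n , λ ℓ len-ℓ →
                   subst (MonoCond (suc s) μ) (HasLength-unique μ-length len-ℓ) μ-mono)
      where
      μ-mono : MonoCond (suc s) μ L
      μ-mono = ≤-trans (μ≤ 0) (subst (suc n ≤_) (+-comm 1 L) (s≤s n≤L))
             , λ nz → residue-steps⇒energy-step μ m′ (suc s) {{nz}} μ-step-forward μ-step-wrap

mainTheorem13 : (λ′ : Conf) (ℓ s q : ℕ) →
    HasLength λ′ ℓ → 2 ≤ q →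
    Monotone s λ′ → M (q ∸ 1) ≤C λ′ → ℓ ≡ q ∸ 1 →
    Monotone (suc s) (Φ^ q λ′)
mainTheorem13 λ′ ℓ s (suc (suc k)) len (s≤s (s≤s z≤n)) (_ , mono) march refl =
  AboveMarching.StepBound.μ-monotone len march (s≤s z≤n) (mono-at mono)
  where
  mono-at : s ≡ 0 ⊎ (1 ≤ s × ∀ ℓ → HasLength λ′ ℓ → MonoCond s λ′ ℓ) → 1 ≤ s → MonoCond s λ′ ℓ
  mono-at (inj₁ refl)        1≤0 = contradiction 1≤0 λ ()
  mono-at (inj₂ (_ , cond)) _   = cond ℓ len
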